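{- Let $q$ be a prime power, $k,m$ positive integers and $i\ge2$. Let $U$ be an $\mathbb{F}_q$-subspace of $\mathbb{F}_{q^m}^k$ of dimension $n$ such that $L_U$ is an $i$-club in $\mathrm{PG}(k-1,q^m)$. Then there exists an $\mathbb{F}_q$-subspace $U'$ of dimension $n-1$ such that $L_{U'}$ is an $(i-1)$-club and $L_{U'}\subseteq L_U$. In particular, for every $j\in\{1,\ldots,i-1\}$ there exists an $\mathbb{F}_q$-subspace $U'$ of dimension $n-j$ such that $L_{U'}$ is an $(i-j)$-club.
   Context: $L_U=\{\langle u\rangle_{\mathbb{F}_{q^m}} : u\in U\setminus\{0\}\}$ has rank $\dim_{\mathbb{F}_q}U$; the weight of a point $\langle v\rangle_{\mathbb{F}_{q^m}}$ is $\dim_{\mathbb{F}_q}(U\cap\langle v\rangle_{\mathbb{F}_{q^m}})$; for a positive integer $i$, $L_U$ is an $i$-club if exactly one point of $L_U$ has weight $i$ and all others weight $1$ (a $1$-club thus has all points of weight $1$). -}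

module Defs where

open import Level using (Level; _⊔_; suc)
open import Algebra.Bundles using (CommutativeRing)
open import Data.Nat as ℕ using (ℕ; zero; _^_)
open import Data.Nat.Primality using (Prime)
open import Data.Fin using (Fin) renaming (zero to fzero; suc to fsuc)
open import Data.Product using (Σ; ∃; ∃-syntax; _×_; _,_)
open import Data.Sum using (_⊎_)
open import Relation.Nullary using (¬_)
open import Relation.Binary.PropositionalEquality as ≡ using (_≡_)
open import Function.Bundles using (Inverse)

IsPrimePower : ℕ → Set
IsPrimePower q = ∃[ p ] ∃[ e ] (Prime p × 1 ℕ.≤ e × q ≡ p ^ e)

module _ {c ℓ : Level} (R : CommutativeRing c ℓ) where
  open CommutativeRing R

  IsField : Set (c ⊔ ℓ)
  IsField = (¬ (1# ≈ 0#)) × (∀ x → ¬ (x ≈ 0#) → ∃[ y ] (x * y ≈ 1#))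

  HasSize : ℕ → Set (c ⊔ ℓ)
  HasSize N = Inverse (≡.setoid (Fin N)) setoid

  record IsSubfieldOfSize {ℓK : Level} (K : Carrier → Set ℓK) (q : ℕ) : Set (c ⊔ ℓ ⊔ ℓK) where
    field
      resp   : ∀ {x y} → x ≈ y → K x → K y
      has0   : K 0#
      has1   : K 1#
      has+   : ∀ {x y} → K x → K y → K (x + y)
      has-   : ∀ {x} → K x → K (- x)
      has*   : ∀ {x y} → K x → K y → K (x * y)
      hasInv : ∀ {x y} → K x → x * y ≈ 1# → K y
      size   : Inverse (≡.setoid (Fin q)) (record
                 { Carrier = Σ Carrier K
                 ; _≈_ = λ a b → Σ.proj₁ a ≈ Σ.proj₁ b
                 ; isEquivalence = record
                     { refl = refl ; sym = sym ; trans = trans } })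

-- Projective geometry over F = R (playing F_{q^m}) with subfield K (playing F_q),
-- in the vector space F^k.
module Geometry {c ℓ ℓK : Level} (R : CommutativeRing c ℓ)
                (K : CommutativeRing.Carrier R → Set ℓK) (k : ℕ) where
  open CommutativeRing R

  Vect : Set c
  Vect = Fin k → Carrier

  _≈ᵥ_ : Vect → Vect → Set ℓ
  u ≈ᵥ v = ∀ t → u t ≈ v t

  0ᵥ : Vect
  0ᵥ _ = 0#

  _+ᵥ_ : Vect → Vect → Vect
  (u +ᵥ v) t = u t + v t

  _·_ : Carrier → Vect → Vect
  (a · v) t = a * v t

  Nonzero : Vect → Set ℓ
  Nonzero v = ¬ (v ≈ᵥ 0ᵥ)

  lincomb : (d : ℕ) → (Fin d → Carrier) → (Fin d → Vect) → Vect
  lincomb zero      cs bs = 0ᵥ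
  lincomb (ℕ.suc d) cs bs = (cs fzero · bs fzero)
                            +ᵥ lincomb d (λ j → cs (fsuc j)) (λ j → bs (fsuc j))

  record IsKSubspace {ℓW : Level} (W : Vect → Set ℓW) : Set (c ⊔ ℓ ⊔ ℓK ⊔ ℓW) where
    field
      resp  : ∀ {u v} → u ≈ᵥ v → W u → W v
      has0  : W 0ᵥ
      has+  : ∀ {u v} → W u → W v → W (u +ᵥ v)
      has·  : ∀ {a v} → K a → W v → W (a · v)

  HasDim : {ℓW : Level} → (Vect → Set ℓW) → ℕ → Set (c ⊔ ℓ ⊔ ℓK ⊔ ℓW)
  HasDim W d = ∃[ bs ] ((∀ j → W (bs j))
             × (∀ (cs : Fin d → Carrier) → (∀ j → K (cs j))
                  → lincomb d cs bs ≈ᵥ 0ᵥ → ∀ j → cs j ≈ 0#)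
             × (∀ u → W u → ∃[ cs ] ((∀ j → K (cs j)) × u ≈ᵥ lincomb d cs bs)))

  Span : Vect → Vect → Set (c ⊔ ℓ)
  Span v u = ∃[ a ] (u ≈ᵥ (a · v))

  SamePoint : Vect → Vect → Set (c ⊔ ℓ)
  SamePoint u v = ∃[ a ] ((¬ (a ≈ 0#)) × u ≈ᵥ (a · v))

  Weight : {ℓU : Level} → (Vect → Set ℓU) → Vect → ℕ → Set (c ⊔ ℓ ⊔ ℓK ⊔ ℓU)
  Weight U v w = HasDim (λ u → U u × Span v u) w

  -- L_U is an i-club (i ≥ 1).  Points of L_U are ⟨u⟩_F, u ∈ U \ {0}.
  Club : {ℓU : Level} → ℕ → (Vect → Set ℓU) → Set (c ⊔ ℓ ⊔ ℓK ⊔ ℓU)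
  Club i U =
      (i ≡ 1 × (∀ u → U u → Nonzero u → Weight U u 1))
    ⊎ (2 ℕ.≤ i × ∃[ v ] (U v × Nonzero v × Weight U v i
         × (∀ u → U u → Nonzero u → ¬ SamePoint u v → Weight U u 1)))

  _⊆L_ : {ℓ₁ ℓ₂ : Level} → (Vect → Set ℓ₁) → (Vect → Set ℓ₂) → Set (c ⊔ ℓ ⊔ ℓ₁ ⊔ ℓ₂)
  U' ⊆L U = ∀ u' → U' u' → Nonzero u' → ∃[ u ] (U u × Nonzero u × SamePoint u' u)

-- Let v be the point of weight i ≥ 2, let w₀, …, w_{i-1} be a K-basis of U ∩ ⟨v⟩ and b₀, …, b_{n-1}
-- a K-basis of U. Choose j such that the j-th coordinate e of w₀ is nonzero, and let H ⊆ U be the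
-- K-span of the b's other than b_j, of dimension n − 1. No nonzero K-multiple of w₀ lies in H,
-- whereas each w_{l+1} − (e_l / e) w₀ does (e_l the j-th coordinate of w_{l+1}); hence these i − 1
-- vectors form a K-basis of H ∩ ⟨v⟩, and ⟨v⟩ has weight i − 1 in L_H. Every other point of L_H has
-- weight 1 in L_U and so also in L_H. Thus L_H ⊆ L_U is an (i − 1)-club; iterate for the rest.
module Submission where

open import Defs
open import Level using (Level; _⊔_)
open import Algebra.Bundles using (CommutativeRing)
open import Data.Nat using (ℕ; _≤_; _∸_; _^_)
open import Data.Product using (Σ; ∃; ∃-syntax; _×_; _,_)

open import Data.Empty using (⊥-elim)
open import Data.Fin using (Fin; punchIn) renaming (zero to fzero; suc to fsuc)
import Data.Fin.Properties as FinP
open import Data.Nat using (zero; suc; s≤s; z≤n)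
open import Data.Nat.Properties using (∸-+-assoc)
open import Data.Product using (proj₁; proj₂)
open import Data.Sum using (inj₁; inj₂)
open import Data.Vec.Functional using (_∷_; insertAt; removeAt; replicate)
open import Data.Vec.Functional.Properties using (insertAt-lookup; insertAt-punchIn; removeAt-insertAt)
open import Data.Vec.Functional.Relation.Unary.All using (All)
open import Function using (_∘_)
open import Function.Bundles using (Inverse)
open import Function.Properties.Inverse using (Inverse⇒Injection) renaming (sym to Inverse-sym)
open import Relation.Binary using (Decidable)
open import Relation.Binary.PropositionalEquality as ≡ using (_≡_)
open import Relation.Nullary using (¬_; Dec; yes; no; ¬?; contradiction)
open import Relation.Nullary.Decidable using (via-injection; map′; _×-dec_)

insertAt⁺ : ∀ {a p} {A : Set a} (P : A → Set p) {d} {xs : Fin d → A} j {x} →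
            All P xs → P x → All P (insertAt xs j x)
insertAt⁺ P               fzero    Pxs Px fzero    = Px
insertAt⁺ P               fzero    Pxs Px (fsuc s) = Pxs s
insertAt⁺ P {d = suc d} (fsuc j) Pxs Px fzero    = Pxs fzero
insertAt⁺ P {d = suc d} (fsuc j) Pxs Px (fsuc s) = insertAt⁺ P j (Pxs ∘ fsuc) Px s

module FieldProperties {c ℓ} (F : CommutativeRing c ℓ) (isField : IsField F) where
  open CommutativeRing F
  open import Relation.Binary.Reasoning.Setoid setoid

  1≉0 : ¬ 1# ≈ 0#
  1≉0 = proj₁ isField

  inverse : ∀ x → ¬ x ≈ 0# → Carrier
  inverse x x≉0 = proj₁ (proj₂ isField x x≉0)

  *-inverseʳ : ∀ x (x≉0 : ¬ x ≈ 0#) → x * inverse x x≉0 ≈ 1#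
  *-inverseʳ x x≉0 = proj₂ (proj₂ isField x x≉0)

  *-inverseˡ : ∀ x (x≉0 : ¬ x ≈ 0#) → inverse x x≉0 * x ≈ 1#
  *-inverseˡ x x≉0 = trans (*-comm _ x) (*-inverseʳ x x≉0)

  inverse≉0 : ∀ x (x≉0 : ¬ x ≈ 0#) → ¬ inverse x x≉0 ≈ 0#
  inverse≉0 x x≉0 x⁻¹≈0 = 1≉0 (begin
    1#                ≈⟨ *-inverseʳ x x≉0 ⟨
    x * inverse x x≉0 ≈⟨ *-congˡ x⁻¹≈0 ⟩
    x * 0#            ≈⟨ zeroʳ x ⟩
    0#                ∎)

  x*y≈0⇒y≈0 : ∀ {x y} → ¬ x ≈ 0# → x * y ≈ 0# → y ≈ 0#
  x*y≈0⇒y≈0 {x} {y} x≉0 xy≈0 = begin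
    y                         ≈⟨ *-identityˡ y ⟨
    1# * y                    ≈⟨ *-congʳ (*-inverseˡ x x≉0) ⟨
    inverse x x≉0 * x * y     ≈⟨ *-assoc _ x y ⟩
    inverse x x≉0 * (x * y)   ≈⟨ *-congˡ xy≈0 ⟩
    inverse x x≉0 * 0#        ≈⟨ zeroʳ _ ⟩
    0#                        ∎

  x*y⁻¹*y≈x : ∀ x {y} (y≉0 : ¬ y ≈ 0#) → x * inverse y y≉0 * y ≈ x
  x*y⁻¹*y≈x x {y} y≉0 = begin
    x * inverse y y≉0 * y   ≈⟨ *-assoc x _ y ⟩
    x * (inverse y y≉0 * y) ≈⟨ *-congˡ (*-inverseˡ y y≉0) ⟩
    x * 1#                  ≈⟨ *-identityʳ x ⟩
    x                       ∎

  *-≉0 : ∀ {x y} → ¬ x ≈ 0# → ¬ y ≈ 0# → ¬ x * y ≈ 0#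
  *-≉0 x≉0 y≉0 xy≈0 = y≉0 (x*y≈0⇒y≈0 x≉0 xy≈0)

module LinearCombinations {c ℓ ℓK} (F : CommutativeRing c ℓ)
  (K : CommutativeRing.Carrier F → Set ℓK) (k : ℕ) where
  open CommutativeRing F
  open import Algebra.Properties.Ring ring using (-1*x≈-x)
  open import Algebra.Properties.Semiring.Sum semiring
    using (sum; sum-syntax; sum-cong-≋; sum-remove; ∑-distrib-+; *-distribˡ-sum; *-distribʳ-sum)
  open Geometry F K k
  open import Relation.Binary.Reasoning.Setoid setoid

  lincomb≡∑ : ∀ d cs bs t → lincomb d cs bs t ≡ ∑[ j < d ] (cs j * bs j t)
  lincomb≡∑ zero    cs bs t = ≡.refl
  lincomb≡∑ (suc d) cs bs t = ≡.cong (cs fzero * bs fzero t +_) (lincomb≡∑ d (cs ∘ fsuc) (bs ∘ fsuc) t)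

  lincomb-cong : ∀ d {cs ds : Fin d → Carrier} bs → (∀ j → cs j ≈ ds j) → lincomb d cs bs ≈ᵥ lincomb d ds bs
  lincomb-cong zero    bs cs≈ds t = refl
  lincomb-cong (suc d) bs cs≈ds t = +-cong (*-congʳ (cs≈ds fzero)) (lincomb-cong d (bs ∘ fsuc) (cs≈ds ∘ fsuc) t)

  lincomb-zero : ∀ d {cs : Fin d → Carrier} (bs : Fin d → Vect) → (∀ j → cs j ≈ 0#) → lincomb d cs bs ≈ᵥ 0ᵥ
  lincomb-zero zero    bs cs≈0 t = refl
  lincomb-zero (suc d) bs cs≈0 t = begin
    _       ≈⟨ +-cong (trans (*-congʳ (cs≈0 fzero)) (zeroˡ _)) (lincomb-zero d (bs ∘ fsuc) (cs≈0 ∘ fsuc) t) ⟩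
    0# + 0# ≈⟨ +-identityʳ 0# ⟩
    0#      ∎

  lincomb-+ : ∀ d (cs ds : Fin d → Carrier) bs →
              lincomb d (λ j → cs j + ds j) bs ≈ᵥ (lincomb d cs bs +ᵥ lincomb d ds bs)
  lincomb-+ d cs ds bs t = begin
    lincomb d (λ j → cs j + ds j) bs t            ≡⟨ lincomb≡∑ d _ bs t ⟩
    ∑[ j < d ] ((cs j + ds j) * bs j t)           ≈⟨ sum-cong-≋ (λ j → distribʳ (bs j t) (cs j) (ds j)) ⟩
    ∑[ j < d ] (cs j * bs j t + ds j * bs j t)    ≈⟨ ∑-distrib-+ {d} _ _ ⟩
    ∑[ j < d ] (cs j * bs j t) + ∑[ j < d ] (ds j * bs j t)
      ≡⟨ ≡.cong₂ _+_ (lincomb≡∑ d cs bs t) (lincomb≡∑ d ds bs t) ⟨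
    lincomb d cs bs t + lincomb d ds bs t         ∎

  lincomb-* : ∀ d a (cs : Fin d → Carrier) bs → lincomb d (λ j → a * cs j) bs ≈ᵥ (a · lincomb d cs bs)
  lincomb-* d a cs bs t = begin
    lincomb d (λ j → a * cs j) bs t     ≡⟨ lincomb≡∑ d _ bs t ⟩
    ∑[ j < d ] (a * cs j * bs j t)      ≈⟨ sum-cong-≋ (λ j → *-assoc a (cs j) (bs j t)) ⟩
    ∑[ j < d ] (a * (cs j * bs j t))    ≈⟨ *-distribˡ-sum {d} a _ ⟨
    a * ∑[ j < d ] (cs j * bs j t)      ≡⟨ ≡.cong (a *_) (lincomb≡∑ d cs bs t) ⟨
    a * lincomb d cs bs t               ∎

  lincomb-neg : ∀ d (cs : Fin d → Carrier) bs t → lincomb d (λ j → - cs j) bs t ≈ - lincomb d cs bs t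
  lincomb-neg d cs bs t = begin
    lincomb d (λ j → - cs j) bs t      ≈⟨ lincomb-cong d bs (λ j → -1*x≈-x (cs j)) t ⟨
    lincomb d (λ j → - 1# * cs j) bs t ≈⟨ lincomb-* d (- 1#) cs bs t ⟩
    - 1# * lincomb d cs bs t           ≈⟨ -1*x≈-x _ ⟩
    - lincomb d cs bs t                ∎

  lincomb-− : ∀ d (cs ds : Fin d → Carrier) bs t →
              lincomb d (λ j → cs j - ds j) bs t ≈ lincomb d cs bs t - lincomb d ds bs t
  lincomb-− d cs ds bs t = trans (lincomb-+ d cs (λ j → - ds j) bs t) (+-congˡ (lincomb-neg d ds bs t))

  lincomb-removeAt : ∀ d (cs : Fin (suc d) → Carrier) bs j →
                     lincomb (suc d) cs bs ≈ᵥ ((cs j · bs j) +ᵥ lincomb d (removeAt cs j) (removeAt bs j))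
  lincomb-removeAt d cs bs j t = begin
    lincomb (suc d) cs bs t                   ≡⟨ lincomb≡∑ (suc d) cs bs t ⟩
    ∑[ s < suc d ] (cs s * bs s t)            ≈⟨ sum-remove {d} {j} (λ s → cs s * bs s t) ⟩
    cs j * bs j t + ∑[ s < d ] (cs (punchIn j s) * bs (punchIn j s) t)
      ≡⟨ ≡.cong (cs j * bs j t +_) (lincomb≡∑ d (removeAt cs j) (removeAt bs j) t) ⟨
    cs j * bs j t + lincomb d (removeAt cs j) (removeAt bs j) t ∎

  lincomb-insertAt : ∀ d (cs : Fin d → Carrier) j c bs →
                     lincomb (suc d) (insertAt cs j c) bs ≈ᵥ ((c · bs j) +ᵥ lincomb d cs (removeAt bs j))
  lincomb-insertAt d cs j c bs t = trans (lincomb-removeAt d (insertAt cs j c) bs j t)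
    (+-cong (*-congʳ (reflexive (insertAt-lookup cs j c)))
            (lincomb-cong d (removeAt bs j) (reflexive ∘ removeAt-insertAt cs j c) t))

  lincomb-insertAt-0# : ∀ d (cs : Fin d → Carrier) j bs →
                        lincomb (suc d) (insertAt cs j 0#) bs ≈ᵥ lincomb d cs (removeAt bs j)
  lincomb-insertAt-0# d cs j bs t =
    trans (lincomb-insertAt d cs j 0# bs t) (trans (+-congʳ (zeroˡ _)) (+-identityˡ _))

  lincomb-insertAt-1# : ∀ d j bs → lincomb (suc d) (insertAt (replicate d 0#) j 1#) bs ≈ᵥ bs j
  lincomb-insertAt-1# d j bs t = trans (lincomb-insertAt d _ j 1# bs t)
    (trans (+-cong (*-identityˡ _) (lincomb-zero d (removeAt bs j) (λ _ → refl) t)) (+-identityʳ _))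

  lincomb-shear : ∀ d (cs ts : Fin d → Carrier) us z →
                  lincomb d cs (λ l → us l +ᵥ (ts l · z))
                    ≈ᵥ lincomb (suc d) ((∑[ l < d ] (cs l * ts l)) ∷ cs) (z ∷ us)
  lincomb-shear d cs ts us z t = begin
    lincomb d cs (λ l → us l +ᵥ (ts l · z)) t                 ≡⟨ lincomb≡∑ d cs _ t ⟩
    ∑[ l < d ] (cs l * (us l t + ts l * z t))                 ≈⟨ sum-cong-≋ (λ l → distribˡ (cs l) _ _) ⟩
    ∑[ l < d ] (cs l * us l t + cs l * (ts l * z t))          ≈⟨ ∑-distrib-+ {d} _ _ ⟩
    ∑[ l < d ] (cs l * us l t) + ∑[ l < d ] (cs l * (ts l * z t))
      ≈⟨ +-congˡ (sum-cong-≋ (λ l → *-assoc (cs l) (ts l) (z t))) ⟨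
    ∑[ l < d ] (cs l * us l t) + ∑[ l < d ] (cs l * ts l * z t) ≈⟨ +-congˡ (*-distribʳ-sum {d} (z t) _) ⟨
    ∑[ l < d ] (cs l * us l t) + ∑[ l < d ] (cs l * ts l) * z t ≈⟨ +-comm _ _ ⟩
    ∑[ l < d ] (cs l * ts l) * z t + ∑[ l < d ] (cs l * us l t)
      ≡⟨ ≡.cong (_ +_) (lincomb≡∑ d cs us t) ⟨
    ∑[ l < d ] (cs l * ts l) * z t + lincomb d cs us t        ∎

module Subspaces {c ℓ ℓK} (F : CommutativeRing c ℓ) (K : CommutativeRing.Carrier F → Set ℓK)
  {q} (isK : IsSubfieldOfSize F K q) (k : ℕ) where
  open CommutativeRing F
  open import Algebra.Properties.Ring ring using (x∙y⁻¹≈ε⇒x≈y; -1*x≈-x)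
  open import Algebra.Properties.Semiring.Sum semiring using (sum; sum-syntax)
  open import Data.Vec.Functional.Relation.Binary.Equality.Setoid setoid using (≋-sym; ≋-trans)
  open Geometry F K k
  open LinearCombinations F K k
  open IsSubfieldOfSize isK using () renaming (has0 to K-0#; has1 to K-1#; has+ to K-+; has- to K-‿; has* to K-*)
  open import Relation.Binary.Reasoning.Setoid setoid

  InKSpan : ∀ {d} → (Fin d → Vect) → Vect → Set (c ⊔ ℓ ⊔ ℓK)
  InKSpan {d} bs u = ∃[ cs ] (All K cs × u ≈ᵥ lincomb d cs bs)

  Independent : ∀ {d} → (Fin d → Vect) → Set (c ⊔ ℓ ⊔ ℓK)
  Independent {d} bs = ∀ cs → All K cs → lincomb d cs bs ≈ᵥ 0ᵥ → ∀ j → cs j ≈ 0#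

  -- HasDim W d unfolds to ∃ (IsBasis W).
  IsBasis : ∀ {ℓW d} → (Vect → Set ℓW) → (Fin d → Vect) → Set (c ⊔ ℓ ⊔ ℓK ⊔ ℓW)
  IsBasis W bs = All W bs × Independent bs × (∀ u → W u → InKSpan bs u)

  K-sum : ∀ d {xs : Fin d → Carrier} → All K xs → K (sum xs)
  K-sum zero    Kxs = K-0#
  K-sum (suc d) Kxs = K-+ (Kxs fzero) (K-sum d (Kxs ∘ fsuc))

  lincomb-∈ : ∀ {ℓW} {W : Vect → Set ℓW} → IsKSubspace W →
              ∀ d {cs bs} → All K cs → All W bs → W (lincomb d cs bs)
  lincomb-∈ W-sub zero    Kcs Wbs = IsKSubspace.has0 W-sub
  lincomb-∈ W-sub (suc d) Kcs Wbs = IsKSubspace.has+ W-sub (IsKSubspace.has· W-sub (Kcs fzero) (Wbs fzero))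
                                      (lincomb-∈ W-sub d (Kcs ∘ fsuc) (Wbs ∘ fsuc))

  InKSpan-isKSubspace : ∀ {d} (bs : Fin d → Vect) → IsKSubspace (InKSpan bs)
  InKSpan-isKSubspace {d} bs = record
    { resp = λ { u≈v (cs , Kcs , u≈) → cs , Kcs , ≋-trans (≋-sym u≈v) u≈ }
    ; has0 = (λ _ → 0#) , (λ _ → K-0#) , ≋-sym (lincomb-zero d bs (λ _ → refl))
    ; has+ = λ { (cs , Kcs , u≈) (ds , Kds , v≈) →
                 (λ j → cs j + ds j) , (λ j → K-+ (Kcs j) (Kds j)) ,
                 ≋-trans (λ t → +-cong (u≈ t) (v≈ t)) (≋-sym (lincomb-+ d cs ds bs)) }
    ; has· = λ { {a} Ka (cs , Kcs , u≈) →
                 (λ j → a * cs j) , (λ j → K-* Ka (Kcs j)) ,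
                 ≋-trans (λ t → *-congˡ (u≈ t)) (≋-sym (lincomb-* d a cs bs)) }
    }

  Span-isKSubspace : ∀ v → IsKSubspace (Span v)
  Span-isKSubspace v = record
    { resp = λ { u≈w (a , u≈) → a , ≋-trans (≋-sym u≈w) u≈ }
    ; has0 = 0# , λ t → sym (zeroˡ _)
    ; has+ = λ { (a , u≈) (b , w≈) → a + b , λ t → trans (+-cong (u≈ t) (w≈ t)) (sym (distribʳ _ a b)) }
    ; has· = λ { {x} _ (b , u≈) → x * b , λ t → trans (*-congˡ (u≈ t)) (sym (*-assoc x b _)) }
    }

  ∩-isKSubspace : ∀ {ℓP ℓQ} {P : Vect → Set ℓP} {Q : Vect → Set ℓQ} →
                  IsKSubspace P → IsKSubspace Q → IsKSubspace (λ x → P x × Q x)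
  ∩-isKSubspace P-sub Q-sub = record
    { resp = λ { x≈y (Px , Qx) → P.resp x≈y Px , Q.resp x≈y Qx }
    ; has0 = P.has0 , Q.has0
    ; has+ = λ { (Px , Qx) (Py , Qy) → P.has+ Px Py , Q.has+ Qx Qy }
    ; has· = λ { Ka (Px , Qx) → P.has· Ka Px , Q.has· Ka Qx }
    }
    where
    module P = IsKSubspace P-sub
    module Q = IsKSubspace Q-sub

  HasDim-resp : ∀ {ℓP ℓQ} {P : Vect → Set ℓP} {Q : Vect → Set ℓQ} {d} →
                (∀ x → P x → Q x) → (∀ x → Q x → P x) → HasDim P d → HasDim Q d
  HasDim-resp P⊆Q Q⊆P (bs , Pbs , indep , spans) = bs , (λ j → P⊆Q _ (Pbs j)) , indep , (λ u → spans u ∘ Q⊆P u)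

  InKSpan-basis : ∀ {d} (bs : Fin d → Vect) j → InKSpan bs (bs j)
  InKSpan-basis {suc d} bs j =
    insertAt (replicate d 0#) j 1# , insertAt⁺ K j (λ _ → K-0#) K-1# , ≋-sym (lincomb-insertAt-1# d j bs)

  independent-removeAt : ∀ {d} {bs : Fin (suc d) → Vect} j → Independent bs → Independent (removeAt bs j)
  independent-removeAt {d} {bs} j indep cs Kcs cs·bs≈0 s = begin
    cs s                           ≡⟨ insertAt-punchIn cs j 0# s ⟨
    insertAt cs j 0# (punchIn j s) ≈⟨ indep (insertAt cs j 0#) (insertAt⁺ K j Kcs K-0#)
                                       (≋-trans (lincomb-insertAt-0# d cs j bs) cs·bs≈0) (punchIn j s) ⟩
    0#                             ∎

  coordinates-unique : ∀ {d} {bs : Fin d → Vect} → Independent bs → ∀ {cs ds} → All K cs → All K ds →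
                       lincomb d cs bs ≈ᵥ lincomb d ds bs → ∀ j → cs j ≈ ds j
  coordinates-unique {d} {bs} indep {cs} {ds} Kcs Kds cs≈ds j =
    x∙y⁻¹≈ε⇒x≈y _ _ (indep (λ j → cs j - ds j) (λ j → K-+ (Kcs j) (K-‿ (Kds j))) difference≈0 j)
    where
    difference≈0 : lincomb d (λ j → cs j - ds j) bs ≈ᵥ 0ᵥ
    difference≈0 t = begin
      lincomb d (λ j → cs j - ds j) bs t      ≈⟨ lincomb-− d cs ds bs t ⟩
      lincomb d cs bs t - lincomb d ds bs t   ≈⟨ +-congʳ (cs≈ds t) ⟩
      lincomb d ds bs t - lincomb d ds bs t   ≈⟨ -‿inverseʳ _ ⟩
      0#                                      ∎

  shear : ∀ {d} → (Fin (suc d) → Vect) → (Fin d → Carrier) → Fin d → Vect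
  shear w ts l = w (fsuc l) +ᵥ (ts l · w fzero)

  shear-isBasis : ∀ {ℓW ℓY} {W : Vect → Set ℓW} {Y : Vect → Set ℓY} {d} {w : Fin (suc d) → Vect} {ts} →
                  IsBasis W w → IsKSubspace Y → (∀ x → Y x → W x) →
                  (∀ s → K s → Y (s · w fzero) → s ≈ 0#) → All K ts → All Y (shear w ts) →
                  IsBasis Y (shear w ts)
  shear-isBasis {Y = Y} {d} {w} {ts} (_ , w-indep , w-spans) Y-sub Y⊆W w₀∉Y Kts Y-shear =
    Y-shear , independent , spans
    where
    open IsKSubspace Y-sub

    independent : Independent (shear w ts)
    independent cs Kcs cs·w′≈0 l =
      w-indep (_ ∷ cs) (λ { fzero → K-sum d (λ l → K-* (Kcs l) (Kts l)) ; (fsuc l) → Kcs l })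
              (≋-trans (≋-sym (lincomb-shear d cs ts (w ∘ fsuc) (w fzero))) cs·w′≈0) (fsuc l)

    -- With D the w-coordinates of y, y′ = Σ D_{l+1} (shear w ts l) differs from y by a K-multiple
    -- of w₀ lying in Y, which must vanish.
    spans : ∀ y → Y y → InKSpan (shear w ts) y
    spans y Yy = D ∘ fsuc , KD ∘ fsuc , y≈y′
      where
      y-coordinates : InKSpan w y
      y-coordinates = w-spans y (Y⊆W y Yy)
      D : Fin (suc d) → Carrier
      D = proj₁ y-coordinates
      KD : All K D
      KD = proj₁ (proj₂ y-coordinates)
      y≈D·w : y ≈ᵥ lincomb (suc d) D w
      y≈D·w = proj₂ (proj₂ y-coordinates)
      S : Carrier
      S = ∑[ l < d ] (D (fsuc l) * ts l)
      KS : K S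
      KS = K-sum d (λ l → K-* (KD (fsuc l)) (Kts l))
      y′ : Vect
      y′ = lincomb d (D ∘ fsuc) (shear w ts)
      y′≈ : y′ ≈ᵥ lincomb (suc d) (S ∷ D ∘ fsuc) w
      y′≈ = lincomb-shear d (D ∘ fsuc) ts (w ∘ fsuc) (w fzero)
      [D₀-S]·w₀≈y-y′ : ((D fzero - S) · w fzero) ≈ᵥ (y +ᵥ ((- 1#) · y′))
      [D₀-S]·w₀≈y-y′ t = begin
        (D fzero - S) * w fzero t
          ≈⟨ +-identityʳ _ ⟨
        (D fzero - S) * w fzero t + 0#
          ≈⟨ +-congˡ (lincomb-zero d (w ∘ fsuc) (λ l → -‿inverseʳ (D (fsuc l))) t) ⟨
        lincomb (suc d) (λ j → D j - (S ∷ D ∘ fsuc) j) w t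
          ≈⟨ lincomb-− (suc d) D (S ∷ D ∘ fsuc) w t ⟩
        lincomb (suc d) D w t - lincomb (suc d) (S ∷ D ∘ fsuc) w t
          ≈⟨ +-congˡ (-‿cong (y′≈ t)) ⟨
        lincomb (suc d) D w t - y′ t
          ≈⟨ +-congʳ (y≈D·w t) ⟨
        y t - y′ t
          ≈⟨ +-congˡ (-1*x≈-x _) ⟨
        y t + - 1# * y′ t
          ∎
      D₀≈S : D fzero ≈ S
      D₀≈S = x∙y⁻¹≈ε⇒x≈y _ _ (w₀∉Y _ (K-+ (KD fzero) (K-‿ KS))
               (resp (≋-sym [D₀-S]·w₀≈y-y′)
                     (has+ Yy (has· (K-‿ K-1#) (lincomb-∈ Y-sub d (KD ∘ fsuc) Y-shear)))))
      y≈y′ : y ≈ᵥ y′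
      y≈y′ = ≋-trans y≈D·w (≋-trans (lincomb-cong (suc d) w D≈S∷D) (≋-sym y′≈))
        where
        D≈S∷D : ∀ j → D j ≈ (S ∷ D ∘ fsuc) j
        D≈S∷D fzero    = D₀≈S
        D≈S∷D (fsuc l) = refl

module FiniteRing {c ℓ} (F : CommutativeRing c ℓ) {N} (size : HasSize F N) where
  open CommutativeRing F
  open Inverse size using (to; from; strictlyInverseˡ)

  infix 4 _≟_
  _≟_ : Decidable _≈_
  _≟_ = via-injection (Inverse⇒Injection (Inverse-sym size)) FinP._≟_

  ∃? : ∀ {p} {P : Carrier → Set p} → (∀ {x y} → x ≈ y → P x → P y) → (∀ x → Dec (P x)) → Dec (∃ P)
  ∃? resp P? = map′ (λ (i , Pi) → to i , Pi) (λ (x , Px) → from x , resp (sym (strictlyInverseˡ x)) Px)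
                    (FinP.any? (P? ∘ to))

module Points {c ℓ ℓK} (F : CommutativeRing c ℓ) (isField : IsField F) (_≟_ : Decidable (CommutativeRing._≈_ F))
  (K : CommutativeRing.Carrier F → Set ℓK) {q} (isK : IsSubfieldOfSize F K q) (k : ℕ) where
  open CommutativeRing F
  open FieldProperties F isField
  open Geometry F K k
  open LinearCombinations F K k
  open Subspaces F K isK k
  open IsSubfieldOfSize isK using () renaming (has0 to K-0#; has1 to K-1#; has* to K-*; hasInv to K-⁻¹)
  open import Data.Vec.Functional.Relation.Binary.Equality.Setoid setoid using (≋-trans)
  open import Relation.Binary.Reasoning.Setoid setoid

  ·≈0⇒≈0 : ∀ {a v} → Nonzero v → (a · v) ≈ᵥ 0ᵥ → a ≈ 0#
  ·≈0⇒≈0 {a} v≉0 a·v≈0 with a ≟ 0#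
  ... | yes a≈0 = a≈0
  ... | no  a≉0 = contradiction (λ t → x*y≈0⇒y≈0 a≉0 (a·v≈0 t)) v≉0

  nonzero⇒coordinate≉0 : ∀ {d v} cs (bs : Fin d → Vect) → Nonzero v → v ≈ᵥ lincomb d cs bs → ∃[ j ] ¬ cs j ≈ 0#
  nonzero⇒coordinate≉0 {d} cs bs v≉0 v≈cs·bs =
    FinP.¬∀⟶∃¬ d _ (λ j → cs j ≟ 0#) (λ cs≈0 → v≉0 (≋-trans v≈cs·bs (lincomb-zero d bs cs≈0)))

  independent⇒nonzero : ∀ {d} {bs : Fin d → Vect} → Independent bs → ∀ j → Nonzero (bs j)
  independent⇒nonzero {suc d} {bs} indep j bsj≈0 = 1≉0 (begin
    1#                               ≡⟨ insertAt-lookup (replicate d 0#) j 1# ⟨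
    insertAt (replicate d 0#) j 1# j ≈⟨ indep _ (insertAt⁺ K j (λ _ → K-0#) K-1#)
                                          (≋-trans (lincomb-insertAt-1# d j bs) bsj≈0) j ⟩
    0#                               ∎)

  Span-refl : ∀ {v} → Span v v
  Span-refl = 1# , λ t → sym (*-identityˡ _)

  Span⇒SamePoint : ∀ {u v} → Nonzero u → Span v u → SamePoint u v
  Span⇒SamePoint u≉0 (a , u≈a·v) =
    a , (λ a≈0 → u≉0 (λ t → trans (u≈a·v t) (trans (*-congʳ a≈0) (zeroˡ _)))) , u≈a·v

  SamePoint-sym : ∀ {u v} → SamePoint u v → SamePoint v u
  SamePoint-sym {u} {v} (a , a≉0 , u≈a·v) = inverse a a≉0 , inverse≉0 a a≉0 , λ t → begin
    v t                        ≈⟨ *-identityˡ _ ⟨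
    1# * v t                   ≈⟨ *-congʳ (*-inverseˡ a a≉0) ⟨
    inverse a a≉0 * a * v t    ≈⟨ *-assoc _ a _ ⟩
    inverse a a≉0 * (a * v t)  ≈⟨ *-congˡ (u≈a·v t) ⟨
    inverse a a≉0 * u t        ∎

  SamePoint-trans : ∀ {u v w} → SamePoint u v → SamePoint v w → SamePoint u w
  SamePoint-trans (a , a≉0 , u≈a·v) (b , b≉0 , v≈b·w) =
    a * b , *-≉0 a≉0 b≉0 , λ t → trans (u≈a·v t) (trans (*-congˡ (v≈b·w t)) (sym (*-assoc a b _)))

  Span-⊆ : ∀ {u v} → SamePoint u v → ∀ x → Span u x → Span v x
  Span-⊆ (a , _ , u≈a·v) x (b , x≈b·u) =
    b * a , λ t → trans (x≈b·u t) (trans (*-congˡ (u≈a·v t)) (sym (*-assoc b a _)))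

  Weight-resp : ∀ {ℓU} {U : Vect → Set ℓU} {u v w} → SamePoint u v → Weight U v w → Weight U u w
  Weight-resp u~v = HasDim-resp (λ x (Ux , vx) → Ux , Span-⊆ (SamePoint-sym u~v) x vx)
                                (λ x (Ux , ux) → Ux , Span-⊆ u~v x ux)

  ⊆⇒⊆L : ∀ {ℓ₁ ℓ₂} {U′ : Vect → Set ℓ₁} {U : Vect → Set ℓ₂} → (∀ x → U′ x → U x) → U′ ⊆L U
  ⊆⇒⊆L U′⊆U u U′u u≉0 = u , U′⊆U u U′u , u≉0 , 1# , 1≉0 , λ t → sym (*-identityˡ _)

  ·-rebase : ∀ {a b x u e} (b≉0 : ¬ b ≈ 0#) → x ≈ᵥ (a · e) → u ≈ᵥ (b · e) → x ≈ᵥ ((a * inverse b b≉0) · u)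
  ·-rebase {a} {b} {x} {u} {e} b≉0 x≈a·e u≈b·e t = begin
    x t                                     ≈⟨ x≈a·e t ⟩
    a * e t                                 ≈⟨ *-congʳ (x*y⁻¹*y≈x a b≉0) ⟨
    a * inverse b b≉0 * b * e t             ≈⟨ *-assoc _ b _ ⟩
    a * inverse b b≉0 * (b * e t)           ≈⟨ *-congˡ (u≈b·e t) ⟨
    a * inverse b b≉0 * u t                 ∎

  hasDim₁⇒multiples : ∀ {ℓW} {W : Vect → Set ℓW} {u} → HasDim W 1 → W u → Nonzero u →
                      ∀ x → W x → ∃[ a ] (K a × x ≈ᵥ (a · u))
  hasDim₁⇒multiples {u = u} (e , _ , _ , spans) Wu u≉0 x Wx
    with spans u Wu | spans x Wx
  ... | cu , Kcu , u≈cu·e | cx , Kcx , x≈cx·e =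
    cx fzero * inverse (cu fzero) cu≉0 , K-* (Kcx fzero) (K-⁻¹ (Kcu fzero) (*-inverseʳ _ cu≉0)) ,
    ·-rebase cu≉0 (λ t → trans (x≈cx·e t) (+-identityʳ _)) (λ t → trans (u≈cu·e t) (+-identityʳ _))
    where
    cu≉0 : ¬ cu fzero ≈ 0#
    cu≉0 cu≈0 = u≉0 (λ t → trans (u≈cu·e t) (trans (+-identityʳ _) (trans (*-congʳ cu≈0) (zeroˡ _))))

  multiples⇒hasDim₁ : ∀ {ℓW} {W : Vect → Set ℓW} {u} → W u → Nonzero u →
                      (∀ x → W x → ∃[ a ] (K a × x ≈ᵥ (a · u))) → HasDim W 1
  multiples⇒hasDim₁ {W = W} {u} Wu u≉0 multiples = (λ _ → u) , (λ _ → Wu) , independent , spans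
    where
    independent : Independent (λ (_ : Fin 1) → u)
    independent cs _ cs·u≈0 fzero = ·≈0⇒≈0 u≉0 (λ t → trans (sym (+-identityʳ _)) (cs·u≈0 t))
    spans : ∀ x → W x → InKSpan (λ (_ : Fin 1) → u) x
    spans x Wx with multiples x Wx
    ... | a , Ka , x≈a·u = (λ _ → a) , (λ _ → Ka) , λ t → trans (x≈a·u t) (sym (+-identityʳ _))

  Weight₁-⊆ : ∀ {ℓ₁ ℓ₂} {U′ : Vect → Set ℓ₁} {U : Vect → Set ℓ₂} {u} → (∀ x → U′ x → U x) →
              U′ u → Nonzero u → Weight U u 1 → Weight U′ u 1
  Weight₁-⊆ U′⊆U U′u u≉0 weight₁ = multiples⇒hasDim₁ (U′u , Span-refl) u≉0
    (λ x (U′x , ux) → hasDim₁⇒multiples weight₁ (U′⊆U _ U′u , Span-refl) u≉0 x (U′⊆U x U′x , ux))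

module ClubReduction {c ℓ ℓK} (F : CommutativeRing c ℓ) (isField : IsField F)
  (K : CommutativeRing.Carrier F → Set ℓK) {q} (isK : IsSubfieldOfSize F K q) (k : ℕ)
  {N} (size : HasSize F N) where
  open CommutativeRing F
  open import Algebra.Properties.Ring ring using (-‿distribˡ-*)
  open FieldProperties F isField
  open FiniteRing F size
  open Geometry F K k
  open LinearCombinations F K k
  open Subspaces F K isK k
  open Points F isField _≟_ K isK k
  open IsSubfieldOfSize isK using () renaming (has0 to K-0#; has+ to K-+; has- to K-‿; has* to K-*; hasInv to K-⁻¹)
  open import Data.Vec.Functional.Relation.Binary.Equality.Setoid setoid using (≋-sym; ≋-trans)
  open import Relation.Binary.Reasoning.Setoid setoid

  samePoint? : ∀ u v → Dec (SamePoint u v)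
  samePoint? u v = ∃? resp (λ a → ¬? (a ≟ 0#) ×-dec FinP.all? (λ t → u t ≟ a * v t))
    where
    resp : ∀ {a b} → a ≈ b → (¬ a ≈ 0# × u ≈ᵥ (a · v)) → (¬ b ≈ 0# × u ≈ᵥ (b · v))
    resp a≈b (a≉0 , u≈a·v) = (λ b≈0 → a≉0 (trans a≈b b≈0)) , λ t → trans (u≈a·v t) (*-congʳ a≈b)

  heavy⇒Club : ∀ {ℓU} {U : Vect → Set ℓU} i {v} → U v → Nonzero v → Weight U v (suc i) →
               (∀ u → U u → Nonzero u → ¬ SamePoint u v → Weight U u 1) → Club (suc i) U
  heavy⇒Club {U = U} zero {v} Uv v≉0 weight-v light =
    inj₁ (≡.refl , λ u Uu u≉0 → weight₁ u Uu u≉0 (samePoint? u v))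
    where
    weight₁ : ∀ u → U u → Nonzero u → Dec (SamePoint u v) → Weight U u 1
    weight₁ u Uu u≉0 (yes u~v) = Weight-resp u~v weight-v
    weight₁ u Uu u≉0 (no  u≁v) = light u Uu u≉0 u≁v
  heavy⇒Club (suc i) Uv v≉0 weight-v light = inj₂ (s≤s (s≤s z≤n) , _ , Uv , v≉0 , weight-v , light)

  module Hyperplane {ℓU} {U : Vect → Set ℓU} (U-sub : IsKSubspace U)
                    {n} {b : Fin (suc n) → Vect} (b-basis : IsBasis U b) (j : Fin (suc n)) where
    -- Intersecting with U is redundant (the span already lies in U) but puts H in the universe
    -- level demanded of the reduced subspace.
    H : Vect → Set (c ⊔ ℓ ⊔ ℓK ⊔ ℓU)
    H x = U x × InKSpan (removeAt b j) x

    H-isKSubspace : IsKSubspace H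
    H-isKSubspace = ∩-isKSubspace U-sub (InKSpan-isKSubspace (removeAt b j))

    H-hasDim : HasDim H n
    H-hasDim = removeAt b j ,
               (λ s → proj₁ b-basis (punchIn j s) , InKSpan-basis (removeAt b j) s) ,
               independent-removeAt {bs = b} j (proj₁ (proj₂ b-basis)) ,
               (λ _ → proj₂)

    H-∌ : ∀ {x E} → All K E → x ≈ᵥ lincomb (suc n) E b → ¬ E j ≈ 0# → ∀ s → K s → H (s · x) → s ≈ 0#
    H-∌ {E = E} KE x≈E·b Ej≉0 s Ks (_ , cs , Kcs , s·x≈cs·b′) = x*y≈0⇒y≈0 Ej≉0 (begin
      E j * s            ≈⟨ *-comm _ s ⟩
      s * E j            ≈⟨ coordinates-unique {bs = b} (proj₁ (proj₂ b-basis)) (λ t → K-* Ks (KE t))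
                              (insertAt⁺ K j Kcs K-0#) sE·b≈cs·b j ⟩
      insertAt cs j 0# j ≡⟨ insertAt-lookup cs j 0# ⟩
      0#                 ∎)
      where
      sE·b≈cs·b : lincomb (suc n) (λ t → s * E t) b ≈ᵥ lincomb (suc n) (insertAt cs j 0#) b
      sE·b≈cs·b = ≋-trans (lincomb-* (suc n) s E b) (≋-trans (λ t → *-congˡ (≋-sym x≈E·b t))
                    (≋-trans s·x≈cs·b′ (≋-sym (lincomb-insertAt-0# n cs j b))))

    H-∋ : ∀ {x E} → U x → All K E → x ≈ᵥ lincomb (suc n) E b → E j ≈ 0# → H x
    H-∋ {x} {E} Ux KE x≈E·b Ej≈0 = Ux , removeAt E j , KE ∘ punchIn j , λ t → begin
      x t                                                     ≈⟨ x≈E·b t ⟩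
      lincomb (suc n) E b t                                   ≈⟨ lincomb-removeAt n E b j t ⟩
      E j * b j t + lincomb n (removeAt E j) (removeAt b j) t ≈⟨ +-congʳ (trans (*-congʳ Ej≈0) (zeroˡ _)) ⟩
      0# + lincomb n (removeAt E j) (removeAt b j) t          ≈⟨ +-identityˡ _ ⟩
      lincomb n (removeAt E j) (removeAt b j) t               ∎

  module HeavyPoint {ℓU} {U : Vect → Set ℓU} (U-sub : IsKSubspace U)
                    {n} {b : Fin (suc n) → Vect} (b-basis : IsBasis U b)
                    {i v} {w : Fin (suc (suc i)) → Vect} (w-basis : IsBasis (λ x → U x × Span v x) w)
                    (light : ∀ u → U u → Nonzero u → ¬ SamePoint u v → Weight U u 1) where
    w-coordinates : ∀ l → InKSpan b (w l)
    w-coordinates l = proj₂ (proj₂ b-basis) (w l) (proj₁ (proj₁ w-basis l))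

    E : Fin (suc (suc i)) → Fin (suc n) → Carrier
    E l = proj₁ (w-coordinates l)

    KE : ∀ l → All K (E l)
    KE l = proj₁ (proj₂ (w-coordinates l))

    w≈E·b : ∀ l → w l ≈ᵥ lincomb (suc n) (E l) b
    w≈E·b l = proj₂ (proj₂ (w-coordinates l))

    E₀-nonzero : ∃[ j ] ¬ E fzero j ≈ 0#
    E₀-nonzero = nonzero⇒coordinate≉0 (E fzero) b
                   (independent⇒nonzero {bs = w} (proj₁ (proj₂ w-basis)) fzero) (w≈E·b fzero)

    j : Fin (suc n)
    j = proj₁ E₀-nonzero

    E₀j≉0 : ¬ E fzero j ≈ 0#
    E₀j≉0 = proj₂ E₀-nonzero

    open Hyperplane U-sub b-basis j public

    Y : Vect → Set (c ⊔ ℓ ⊔ ℓK ⊔ ℓU)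
    Y x = H x × Span v x

    -- Chosen so that the j-th coordinate of shear w ts l vanishes, i.e. shear w ts l ∈ H.
    ts : Fin (suc i) → Carrier
    ts l = - (E (fsuc l) j * inverse (E fzero j) E₀j≉0)

    Kts : All K ts
    Kts l = K-‿ (K-* (KE (fsuc l) j) (K-⁻¹ (KE fzero j) (*-inverseʳ _ E₀j≉0)))

    Y-shear : All Y (shear w ts)
    Y-shear l = H-∋ (proj₁ W-w′) KG w′≈G·b Gj≈0 , proj₂ W-w′
      where
      open IsKSubspace (∩-isKSubspace U-sub (Span-isKSubspace v))
      W-w′ : U (shear w ts l) × Span v (shear w ts l)
      W-w′ = has+ (proj₁ w-basis (fsuc l)) (has· (Kts l) (proj₁ w-basis fzero))
      G : Fin (suc n) → Carrier
      G t = E (fsuc l) t + ts l * E fzero t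
      KG : All K G
      KG t = K-+ (KE (fsuc l) t) (K-* (Kts l) (KE fzero t))
      w′≈G·b : shear w ts l ≈ᵥ lincomb (suc n) G b
      w′≈G·b t = begin
        w (fsuc l) t + ts l * w fzero t
          ≈⟨ +-cong (w≈E·b (fsuc l) t) (*-congˡ (w≈E·b fzero t)) ⟩
        lincomb (suc n) (E (fsuc l)) b t + ts l * lincomb (suc n) (E fzero) b t
          ≈⟨ +-congˡ (lincomb-* (suc n) (ts l) (E fzero) b t) ⟨
        lincomb (suc n) (E (fsuc l)) b t + lincomb (suc n) (λ s → ts l * E fzero s) b t
          ≈⟨ lincomb-+ (suc n) (E (fsuc l)) (λ s → ts l * E fzero s) b t ⟨
        lincomb (suc n) G b t ∎
      Gj≈0 : G j ≈ 0#
      Gj≈0 = begin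
        E (fsuc l) j + ts l * E fzero j
          ≈⟨ +-congˡ (-‿distribˡ-* _ _) ⟨
        E (fsuc l) j - E (fsuc l) j * inverse (E fzero j) E₀j≉0 * E fzero j
          ≈⟨ +-congˡ (-‿cong (x*y⁻¹*y≈x _ E₀j≉0)) ⟩
        E (fsuc l) j - E (fsuc l) j
          ≈⟨ -‿inverseʳ _ ⟩
        0#
          ∎

    Y-basis : IsBasis Y (shear w ts)
    Y-basis = shear-isBasis w-basis (∩-isKSubspace H-isKSubspace (Span-isKSubspace v))
                (λ x ((Ux , _) , vx) → Ux , vx)
                (λ s Ks (Hs·w₀ , _) → H-∌ (KE fzero) (w≈E·b fzero) E₀j≉0 s Ks Hs·w₀)
                Kts Y-shear

    v′ : Vect
    v′ = shear w ts fzero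

    v′≉0 : Nonzero v′
    v′≉0 = independent⇒nonzero {bs = shear w ts} (proj₁ (proj₂ Y-basis)) fzero

    v′~v : SamePoint v′ v
    v′~v = Span⇒SamePoint v′≉0 (proj₂ (Y-shear fzero))

    H-club : Club (suc i) H
    H-club = heavy⇒Club i (proj₁ (Y-shear fzero)) v′≉0 (Weight-resp v′~v (shear w ts , Y-basis)) light′
      where
      light′ : ∀ u → H u → Nonzero u → ¬ SamePoint u v′ → Weight H u 1
      light′ u Hu u≉0 u≁v′ = Weight₁-⊆ (λ _ → proj₁) Hu u≉0
        (light u (proj₁ Hu) u≉0 (λ u~v → u≁v′ (SamePoint-trans u~v (SamePoint-sym v′~v))))

  club-reduce : ∀ {ℓU} {U : Vect → Set ℓU} {n i} → 2 ≤ i → IsKSubspace U → HasDim U n → Club i U →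
                ∃[ U′ ] (IsKSubspace {c ⊔ ℓ ⊔ ℓK ⊔ ℓU} U′ × HasDim U′ (n ∸ 1) × Club (i ∸ 1) U′ × U′ ⊆L U)
  club-reduce (s≤s (s≤s z≤n)) _ _ (inj₁ (() , _))
  club-reduce {n = zero} (s≤s (s≤s z≤n)) U-sub (b , b-basis) (inj₂ (_ , v , Uv , v≉0 , _)) =
    ⊥-elim (v≉0 (proj₂ (proj₂ (proj₂ (proj₂ b-basis) v Uv))))
  club-reduce {n = suc n} (s≤s (s≤s z≤n)) U-sub (b , b-basis)
              (inj₂ (_ , _ , _ , _ , (w , w-basis) , light)) =
    H , H-isKSubspace , H-hasDim , H-club , ⊆⇒⊆L (λ _ → proj₁)
    where open HeavyPoint U-sub b-basis w-basis light

  club-reduce⁺ : ∀ j {ℓU} {U : Vect → Set ℓU} {n i} → suc j ≤ i ∸ 1 → IsKSubspace U → HasDim U n → Club i U →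
                 ∃[ U′ ] (IsKSubspace {c ⊔ ℓ ⊔ ℓK ⊔ ℓU} U′ × HasDim U′ (n ∸ suc j) × Club (i ∸ suc j) U′)
  club-reduce⁺ zero {i = suc (suc i)} _ U-sub U-dim U-club with club-reduce (s≤s (s≤s z≤n)) U-sub U-dim U-club
  ... | U′ , U′-sub , U′-dim , U′-club , _ = U′ , U′-sub , U′-dim , U′-club
  club-reduce⁺ (suc j) {n = n} {suc (suc i)} (s≤s j<i) U-sub U-dim U-club
    with club-reduce (s≤s (s≤s z≤n)) U-sub U-dim U-club
  ... | U₁ , U₁-sub , U₁-dim , U₁-club , _ with club-reduce⁺ j j<i U₁-sub U₁-dim U₁-club
  ... | U′ , U′-sub , U′-dim , U′-club =
    U′ , U′-sub , ≡.subst (HasDim U′) (∸-+-assoc n 1 (suc j)) U′-dim , U′-club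

lemma3p1 : {c ℓ ℓK ℓU : Level} (q m k i n : ℕ)
    → IsPrimePower q → 1 ≤ m → 1 ≤ k → 2 ≤ i
    → (F : CommutativeRing c ℓ) → IsField F → HasSize F (q ^ m)
    → (K : CommutativeRing.Carrier F → Set ℓK) → IsSubfieldOfSize F K q
    → (U : Geometry.Vect F K k → Set ℓU)
    → Geometry.IsKSubspace F K k U → Geometry.HasDim F K k U n
    → Geometry.Club F K k i U
    → (∃[ U' ] (Geometry.IsKSubspace F K k {c ⊔ ℓ ⊔ ℓK ⊔ ℓU} U'
                × Geometry.HasDim F K k U' (n ∸ 1)
                × Geometry.Club F K k (i ∸ 1) U'
                × Geometry._⊆L_ F K k U' U))
      × (∀ j → 1 ≤ j → j ≤ i ∸ 1
           → ∃[ U' ] (Geometry.IsKSubspace F K k {c ⊔ ℓ ⊔ ℓK ⊔ ℓU} U'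
                      × Geometry.HasDim F K k U' (n ∸ j)
                      × Geometry.Club F K k (i ∸ j) U'))
lemma3p1 _ _ k _ _ _ _ _ 2≤i F isField size K isK _ U-sub U-dim U-club =
  club-reduce 2≤i U-sub U-dim U-club ,
  λ { zero () ; (suc j) _ 1+j≤i∸1 → club-reduce⁺ j 1+j≤i∸1 U-sub U-dim U-club }
  where open ClubReduction F isField K isK k size
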